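{- Let $D$ be a strongly connected digraph with $n\ge 4$ vertices whose complement $\overline{D}$ is also strongly connected. Then $\xi^C(D)+\xi^C(\overline{D})\ge 2n(n-1)$, with equality if and only if both $D$ and $\overline{D}$ are self-centered with radius two.
   Context: Digraphs have no loops and no parallel arcs. The complement $\overline{D}$ of $D=(V,A)$ is the digraph on $V$ in which, for distinct $u,v$, $(u,v)$ is an arc iff $(u,v)\notin A$. For a strongly connected digraph $D$, $\vec d(u,v)$ is the length of a shortest directed $u$–$v$ path, $md(u,v)=\max\{\vec d(u,v),\vec d(v,u)\}$, $mecc(u)=\max\{md(u,v):v\in V\}$, the radius is $mrad(D)=\min_v mecc(v)$, $mdiam(D)=\max_v mecc(v)$, and $\xi^C(D)=\frac12\sum_{u\in V}(d^+_u+d^-_u)\,mecc(u)$, where $d^+_u,d^-_u$ are the out-degree and in-degree. $D$ is self-centered if $mrad(D)=mdiam(D)$. -}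

module Defs where

open import Data.Nat using (ℕ; zero; suc; _+_; _*_; _⊔_; _⊓_)
open import Data.Bool using (Bool; true; false; not; _∧_; _∨_; if_then_else_)
open import Data.Fin using (Fin; zero; suc; _≟_)
open import Data.List using (List; map; foldr; allFin; filter; length)
open import Data.Nat.ListAction using (sum)
open import Data.Product using (∃)
open import Relation.Nullary.Decidable using (⌊_⌋)
open import Relation.Binary.PropositionalEquality using (_≡_)

record Digraph (n : ℕ) : Set where
  field
    arc   : Fin n → Fin n → Bool
    loopless : ∀ u → arc u u ≡ false
open Digraph public

complement : ∀ {n} → Digraph n → Digraph n
complement {n} D = record { arc = a ; loopless = lf }
  where
  a : Fin n → Fin n → Bool
  a u v = not ⌊ u ≟ v ⌋ ∧ not (arc D u v)
  lf : ∀ u → a u u ≡ false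
  lf u with u ≟ u
  ... | Relation.Nullary.Decidable.yes _ = Relation.Binary.PropositionalEquality.refl
  ... | Relation.Nullary.Decidable.no u≢u = Data.Empty.⊥-elim (u≢u Relation.Binary.PropositionalEquality.refl)
    where import Data.Empty

anyV : ∀ {n} → (Fin n → Bool) → Bool
anyV {n} p = foldr _∨_ false (map p (allFin n))

sumV : ∀ {n} → (Fin n → ℕ) → ℕ
sumV {n} f = sum (map f (allFin n))

maxV : ∀ {n} → (Fin n → ℕ) → ℕ
maxV {n} f = foldr _⊔_ 0 (map f (allFin n))

minV : ∀ {n} → (Fin n → ℕ) → ℕ
minV {zero} f = 0
minV {suc n} f = foldr _⊓_ (f zero) (map f (allFin (suc n)))

reach : ∀ {n} → Digraph n → ℕ → Fin n → Fin n → Bool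
reach D zero u v = ⌊ u ≟ v ⌋
reach D (suc k) u v = reach D k u v ∨ anyV (λ w → reach D k u w ∧ arc D w v)

StronglyConnected : ∀ {n} → Digraph n → Set
StronglyConnected D = ∀ u v → ∃ λ k → reach D k u v ≡ true

least : ℕ → (ℕ → Bool) → ℕ
least zero p = zero
least (suc b) p = if p zero then zero else suc (least b (λ k → p (suc k)))

-- Every shortest walk has length < n, so the
-- search bound n is sufficient; the value n is only returned when v is
-- unreachable from u, which does not occur for strongly connected D.
dist : ∀ {n} → Digraph n → Fin n → Fin n → ℕ
dist {n} D u v = least n (λ k → reach D k u v)

md : ∀ {n} → Digraph n → Fin n → Fin n → ℕ
md D u v = dist D u v ⊔ dist D v u

mecc : ∀ {n} → Digraph n → Fin n → ℕ
mecc D u = maxV (md D u)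

mrad : ∀ {n} → Digraph n → ℕ
mrad D = minV (mecc D)

mdiam : ∀ {n} → Digraph n → ℕ
mdiam D = maxV (mecc D)

SelfCentered : ∀ {n} → Digraph n → Set
SelfCentered D = mrad D ≡ mdiam D

outdeg : ∀ {n} → Digraph n → Fin n → ℕ
outdeg {n} D u = length (filter (λ v → Data.Bool.T? (arc D u v)) (allFin n))
  where import Data.Bool

indeg : ∀ {n} → Digraph n → Fin n → ℕ
indeg {n} D v = length (filter (λ u → Data.Bool.T? (arc D u v)) (allFin n))
  where import Data.Bool

-- twiceXiC D = 2 · ξ^C(D) = Σ_u (d⁺_u + d⁻_u) · mecc(u)
-- (doubled to stay in ℕ)
twiceXiC : ∀ {n} → Digraph n → ℕ
twiceXiC D = sumV (λ u → (outdeg D u + indeg D u) * mecc D u)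

-- Complementing a digraph splits the n − 1 possible out-arcs (and in-arcs) at
-- every vertex u, so d(u) + d̄(u) = 2(n − 1) for the total degrees d = d⁺ + d⁻.
-- If D̄ is strongly connected, u has an out-neighbour in D̄, i.e. a vertex it
-- does not reach in one step in D, so mecc_D(u) ≥ 2; symmetrically
-- mecc_D̄(u) ≥ 2.  Hence the u-th summand of 2ξ^C(D) + 2ξ^C(D̄) is at least
-- 2(d(u) + d̄(u)) = 4(n − 1).  Both degrees are positive, so equality forces
-- every eccentricity in D and in D̄ to be 2, which is exactly self-centredness
-- with radius 2.
module Submission where

open import Defs
open import Data.Nat using (ℕ; _+_; _*_; _∸_; _≤_)
open import Data.Product using (_×_)
open import Relation.Binary.PropositionalEquality using (_≡_)
open import Function.Bundles using (_⇔_)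

open import Algebra.Lattice.Properties.BooleanAlgebra using (deMorgan₂)
open import Algebra.Properties.CommutativeSemigroup using (interchange)
open import Data.Bool using (Bool; true; false; not; _∧_; _∨_; T; T?)
open import Data.Bool.Properties using (T-∨; T-∧; T-not-≡; T-≡; ∨-∧-booleanAlgebra)
open import Data.Empty using (⊥-elim)
open import Data.Fin using (Fin; zero; suc; _≟_)
open import Data.List using (List; []; _∷_; map; foldr; filter; length; allFin)
open import Data.List.Membership.Propositional using (_∈_; lose)
open import Data.List.Membership.Propositional.Properties using (∈-allFin)
open import Data.List.Properties using (filter-accept; filter-reject; filter-none; filter-some; filter-≐; length-tabulate; map-cong)
open import Data.List.Relation.Unary.All as All using ()
open import Data.List.Relation.Unary.AllPairs using (_∷_)
open import Data.List.Relation.Unary.Any using (here; there; satisfied)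
open import Data.List.Relation.Unary.Any.Properties using (any⁻)
open import Data.List.Relation.Unary.Unique.Propositional using (Unique)
open import Data.List.Relation.Unary.Unique.Propositional.Properties using (allFin⁺)
open import Data.Nat using (suc; zero; _⊔_; _⊓_; _<_; z≤n; s≤s; z<s; s<s; NonZero; >-nonZero)
open import Data.Nat.ListAction using (sum)
open import Data.Nat.Properties
  using (≤-trans; ≤-antisym; ≤-reflexive; +-assoc; +-suc; +-identityʳ; +-monoʳ-≤; +-cancelˡ-≡; +-mono-≤; +-cancelʳ-≤; +-commutativeSemigroup;
         *-monoʳ-≤; *-distribʳ-+; *-cancelˡ-≡; m≤m+n; m≤m⊔n; m≤n⊔m; ⊔-lub; m⊓n≤m; m⊓n≤n; ⊓-glb)
open import Data.Nat.Tactic.RingSolver using (solve-∀)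
open import Data.Product using (∃; _,_; proj₁; proj₂)
open import Data.Sum using (_⊎_; inj₁; inj₂)
open import Function using (_∘_; id)
open import Function.Bundles using (mk⇔; module Equivalence)
open import Relation.Binary.PropositionalEquality using (_≢_; refl; sym; trans; cong; cong₂; subst; subst₂; _≗_; module ≡-Reasoning)
open import Relation.Nullary using (¬_; yes; no)
open import Relation.Nullary.Decidable using (⌊_⌋; toWitness; fromWitness; toWitnessFalse)

open Equivalence using (to; from)

+-mono-≤-≡⇒≡ : ∀ {a b c d} → a ≤ b → c ≤ d → a + c ≡ b + d → a ≡ b × c ≡ d
+-mono-≤-≡⇒≡ {a} {b} {c} {d} a≤b c≤d eq = a≡b , +-cancelˡ-≡ a c d (trans eq (cong (_+ d) (sym a≡b)))
  where
  a≡b : a ≡ b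
  a≡b = ≤-antisym a≤b (+-cancelʳ-≤ c b a (≤-trans (+-monoʳ-≤ b c≤d) (≤-reflexive (sym eq))))

[a+b]*c≤a*x+b*y : ∀ {a b c x y} → c ≤ x → c ≤ y → (a + b) * c ≤ a * x + b * y
[a+b]*c≤a*x+b*y {a} {b} {c} c≤x c≤y =
  ≤-trans (≤-reflexive (*-distribʳ-+ c a b)) (+-mono-≤ (*-monoʳ-≤ a c≤x) (*-monoʳ-≤ b c≤y))

[a+b]*c≡a*x+b*y⇔x≡c×y≡c : ∀ {a b c x y} .{{_ : NonZero a}} .{{_ : NonZero b}} → c ≤ x → c ≤ y →
                          ((a + b) * c ≡ a * x + b * y) ⇔ (x ≡ c × y ≡ c)
[a+b]*c≡a*x+b*y⇔x≡c×y≡c {a} {b} {c} {x} {y} c≤x c≤y = mk⇔ fwd bwd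
  where
  fwd : (a + b) * c ≡ a * x + b * y → x ≡ c × y ≡ c
  fwd eq with +-mono-≤-≡⇒≡ (*-monoʳ-≤ a c≤x) (*-monoʳ-≤ b c≤y) (trans (sym (*-distribʳ-+ c a b)) eq)
  ... | ac≡ax , bc≡by = sym (*-cancelˡ-≡ c x a ac≡ax) , sym (*-cancelˡ-≡ c y b bc≡by)

  bwd : x ≡ c × y ≡ c → (a + b) * c ≡ a * x + b * y
  bwd (refl , refl) = *-distribʳ-+ c a b

module _ {A : Set} where

  count : (A → Bool) → List A → ℕ
  count p xs = length (filter (T? ∘ p) xs)

  count-≗ : ∀ {p q : A → Bool} → p ≗ q → ∀ xs → count p xs ≡ count q xs
  count-≗ {p} {q} p≗q xs =
    cong length (filter-≐ (T? ∘ p) (T? ∘ q) ((λ {x} → subst T (p≗q x)) , (λ {x} → subst T (sym (p≗q x)))) xs)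

  count-∨ : ∀ {p q : A → Bool} → (∀ x → T (p x) → ¬ T (q x)) → ∀ xs →
            count (λ x → p x ∨ q x) xs ≡ count p xs + count q xs
  count-∨ disjoint [] = refl
  count-∨ {p} {q} disjoint (x ∷ xs) with p x | q x | disjoint x
  ... | true  | true  | pq = ⊥-elim (pq _ _)
  ... | true  | false | _  = cong suc (count-∨ disjoint xs)
  ... | false | true  | _  = trans (cong suc (count-∨ disjoint xs)) (sym (+-suc _ _))
  ... | false | false | _  = count-∨ disjoint xs

  count-not : ∀ (p : A → Bool) xs → count p xs + count (not ∘ p) xs ≡ length xs
  count-not p [] = refl
  count-not p (x ∷ xs) with p x
  ... | true  = cong suc (count-not p xs)
  ... | false = trans (+-suc _ _) (cong suc (count-not p xs))

  count-≡1 : ∀ {p : A → Bool} {x xs} → Unique xs → x ∈ xs → T (p x) →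
             (∀ {y} → T (p y) → y ≡ x) → count p xs ≡ 1
  count-≡1 {p} (y∉ys ∷ _) (here refl) px only-x =
    cong length (trans (filter-accept (T? ∘ p) px)
      (cong (_ ∷_) (filter-none (T? ∘ p) (All.tabulate λ z∈ys pz → All.lookup y∉ys z∈ys (sym (only-x pz))))))
  count-≡1 {p} (y∉ys ∷ uniq) (there x∈ys) px only-x =
    trans (cong length (filter-reject (T? ∘ p) λ py → All.lookup y∉ys x∈ys (only-x py)))
          (count-≡1 uniq x∈ys px only-x)

  count-complement : ∀ (e r : A → Bool) → (∀ x → T (e x) → ¬ T (r x)) → ∀ xs → count e xs ≡ 1 →
                     count r xs + count (λ x → not (e x) ∧ not (r x)) xs ≡ length xs ∸ 1
  count-complement e r disjoint xs e≡1 = cong (_∸ 1) (begin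
    1 + (count r xs + count neither xs)
      ≡⟨ cong (_+ (count r xs + count neither xs)) (sym e≡1) ⟩
    count e xs + (count r xs + count neither xs)
      ≡⟨ sym (+-assoc (count e xs) _ _) ⟩
    count e xs + count r xs + count neither xs
      ≡⟨ cong₂ _+_ (sym (count-∨ disjoint xs)) (count-≗ (λ x → sym (deMorgan₂ ∨-∧-booleanAlgebra (e x) (r x))) xs) ⟩
    count e∨r xs + count (not ∘ e∨r) xs
      ≡⟨ count-not e∨r xs ⟩
    length xs ∎)
    where
    open ≡-Reasoning
    neither e∨r : A → Bool
    neither x = not (e x) ∧ not (r x)
    e∨r x = e x ∨ r x

  sum-map-+ : ∀ (f g : A → ℕ) xs → sum (map (λ x → f x + g x) xs) ≡ sum (map f xs) + sum (map g xs)
  sum-map-+ f g [] = refl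
  sum-map-+ f g (x ∷ xs) = trans (cong (f x + g x +_) (sum-map-+ f g xs))
                                 (interchange +-commutativeSemigroup (f x) (g x) _ _)

  sum-map-const : ∀ c xs → sum (map (λ (_ : A) → c) xs) ≡ length xs * c
  sum-map-const c [] = refl
  sum-map-const c (x ∷ xs) = cong (c +_) (sum-map-const c xs)

  sum-map-mono : ∀ {f g : A → ℕ} → (∀ x → f x ≤ g x) → ∀ xs → sum (map f xs) ≤ sum (map g xs)
  sum-map-mono f≤g [] = z≤n
  sum-map-mono f≤g (x ∷ xs) = +-mono-≤ (f≤g x) (sum-map-mono f≤g xs)

  sum-map-≡⇒≡ : ∀ {f g : A → ℕ} → (∀ x → f x ≤ g x) → ∀ {xs} →
                sum (map f xs) ≡ sum (map g xs) → ∀ {x} → x ∈ xs → f x ≡ g x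
  sum-map-≡⇒≡ f≤g {y ∷ ys} eq (here refl)  = proj₁ (+-mono-≤-≡⇒≡ (f≤g y) (sum-map-mono f≤g ys) eq)
  sum-map-≡⇒≡ f≤g {y ∷ ys} eq (there x∈ys) =
    sum-map-≡⇒≡ f≤g (proj₂ (+-mono-≤-≡⇒≡ (f≤g y) (sum-map-mono f≤g ys) eq)) x∈ys

  foldr-⊔-≥ : ∀ (f : A → ℕ) z {x xs} → x ∈ xs → f x ≤ foldr _⊔_ z (map f xs)
  foldr-⊔-≥ f z {xs = y ∷ ys} (here refl)  = m≤m⊔n (f y) _
  foldr-⊔-≥ f z {xs = y ∷ ys} (there x∈ys) = ≤-trans (foldr-⊔-≥ f z x∈ys) (m≤n⊔m (f y) _)

  foldr-⊔-lub : ∀ {f : A → ℕ} {z c} → z ≤ c → (∀ x → f x ≤ c) → ∀ xs → foldr _⊔_ z (map f xs) ≤ c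
  foldr-⊔-lub z≤c f≤c []       = z≤c
  foldr-⊔-lub z≤c f≤c (x ∷ xs) = ⊔-lub (f≤c x) (foldr-⊔-lub z≤c f≤c xs)

  foldr-⊓-≤ : ∀ (f : A → ℕ) z {x xs} → x ∈ xs → foldr _⊓_ z (map f xs) ≤ f x
  foldr-⊓-≤ f z {xs = y ∷ ys} (here refl)  = m⊓n≤m (f y) _
  foldr-⊓-≤ f z {xs = y ∷ ys} (there x∈ys) = ≤-trans (m⊓n≤n (f y) _) (foldr-⊓-≤ f z x∈ys)

  foldr-⊓-glb : ∀ {f : A → ℕ} {z c} → c ≤ z → (∀ x → c ≤ f x) → ∀ xs → c ≤ foldr _⊓_ z (map f xs)
  foldr-⊓-glb c≤z c≤f []       = c≤z
  foldr-⊓-glb c≤z c≤f (x ∷ xs) = ⊓-glb (c≤f x) (foldr-⊓-glb c≤z c≤f xs)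

deg : ∀ {n} → Digraph n → Fin n → ℕ
deg D u = outdeg D u + indeg D u

module _ {n} (D : Digraph n) where

  arc⇒≢ : ∀ {u v} → T (arc D u v) → u ≢ v
  arc⇒≢ {u} a refl = subst T (loopless D u) a

  arc-complement⇒ : ∀ {u v} → T (arc (complement D) u v) → u ≢ v × ¬ T (arc D u v)
  arc-complement⇒ ca with to T-∧ ca
  ... | u≢v , ¬a = toWitnessFalse u≢v , λ a → subst T (to T-not-≡ ¬a) a

  arc⇒¬arc-complement : ∀ {u v} → T (arc D u v) → ¬ T (arc (complement D) u v)
  arc⇒¬arc-complement a ca = proj₂ (arc-complement⇒ ca) a

  outdeg-complement : ∀ u → outdeg D u + outdeg (complement D) u ≡ n ∸ 1
  outdeg-complement u = trans
    (count-complement _ (arc D u) (λ v u≡v a → arc⇒≢ a (toWitness u≡v)) (allFin n)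
      (count-≡1 (allFin⁺ n) (∈-allFin u) (fromWitness refl) (sym ∘ toWitness)))
    (cong (_∸ 1) (length-tabulate {n = n} id))

  indeg-complement : ∀ v → indeg D v + indeg (complement D) v ≡ n ∸ 1
  indeg-complement v = trans
    (count-complement _ (λ u → arc D u v) (λ u u≡v a → arc⇒≢ a (toWitness u≡v)) (allFin n)
      (count-≡1 (allFin⁺ n) (∈-allFin v) (fromWitness refl) toWitness))
    (cong (_∸ 1) (length-tabulate {n = n} id))

  deg-complement : ∀ u → deg D u + deg (complement D) u ≡ 2 * (n ∸ 1)
  deg-complement u = begin
    deg D u + deg (complement D) u
      ≡⟨ interchange +-commutativeSemigroup (outdeg D u) (indeg D u) _ _ ⟩
    (outdeg D u + outdeg (complement D) u) + (indeg D u + indeg (complement D) u)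
      ≡⟨ cong₂ _+_ (outdeg-complement u) (indeg-complement u) ⟩
    (n ∸ 1) + (n ∸ 1)
      ≡⟨ cong ((n ∸ 1) +_) (sym (+-identityʳ (n ∸ 1))) ⟩
    2 * (n ∸ 1) ∎
    where open ≡-Reasoning

  arc⇒0<deg : ∀ {u v} → T (arc D u v) → 0 < deg D u
  arc⇒0<deg {u} {v} a = ≤-trans (filter-some (T? ∘ arc D u) (lose (∈-allFin v) a)) (m≤m+n _ _)

module _ {n} (G : Digraph n) where

  reach-out-arc : ∀ k {u v} → T (reach G k u v) → u ≢ v → ∃ λ x → T (arc G u x)
  reach-out-arc zero    r u≢v = ⊥-elim (u≢v (toWitness r))
  reach-out-arc (suc k) {u} {v} r u≢v with to T-∨ r
  ... | inj₁ r′ = reach-out-arc k r′ u≢v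
  ... | inj₂ r′ with satisfied (any⁻ _ (allFin n) r′)
  ...   | w , uw-wv with to T-∧ uw-wv
  ...     | r″ , a with u ≟ w
  ...       | yes refl = v , a
  ...       | no u≢w   = reach-out-arc k r″ u≢w

  reach-1⇒ : ∀ {u v} → T (reach G 1 u v) → u ≡ v ⊎ T (arc G u v)
  reach-1⇒ {u} r with to T-∨ r
  ... | inj₁ u≡v = inj₁ (toWitness u≡v)
  ... | inj₂ r′ with satisfied (any⁻ _ (allFin n) r′)
  ...   | w , uw-wv with to T-∧ uw-wv
  ...     | u≡w , a with toWitness {a? = u ≟ w} u≡w
  ...       | refl = inj₂ a

  dist≤mecc : ∀ u v → dist G u v ≤ mecc G u
  dist≤mecc u v = ≤-trans (m≤m⊔n _ _) (foldr-⊔-≥ (md G u) 0 (∈-allFin v))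

≤-least : ∀ {j} b (p : ℕ → Bool) → j ≤ b → (∀ {k} → k < j → ¬ T (p k)) → j ≤ least b p
≤-least {zero}  b       p _         _  = z≤n
≤-least {suc j} (suc b) p (s≤s j≤b) ¬p with p zero | ¬p {0} z<s
... | true  | ¬p0 = ⊥-elim (¬p0 _)
... | false | _   = s≤s (≤-least b (p ∘ suc) j≤b (¬p ∘ s<s))

module _ {m} (G : Digraph (2 + m)) where

  private
    another : (u : Fin (2 + m)) → ∃ (u ≢_)
    another zero    = suc zero , λ ()
    another (suc _) = zero , λ ()

  ¬arc⇒2≤mecc : ∀ {u v} → u ≢ v → ¬ T (arc G u v) → 2 ≤ mecc G u
  ¬arc⇒2≤mecc {u} {v} u≢v ¬a = ≤-trans (≤-least (2 + m) _ (s≤s (s≤s z≤n)) no-short-walk) (dist≤mecc G u v)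
    where
    no-short-walk : ∀ {k} → k < 2 → ¬ T (reach G k u v)
    no-short-walk z<s             r = u≢v (toWitness r)
    no-short-walk (s<s z<s)       r with reach-1⇒ G r
    ... | inj₁ u≡v = u≢v u≡v
    ... | inj₂ a   = ¬a a

  stronglyConnected⇒out-arc : StronglyConnected G → ∀ u → ∃ λ v → T (arc G u v)
  stronglyConnected⇒out-arc sc u with another u
  ... | v , u≢v with sc u v
  ...   | k , r = reach-out-arc G k (from T-≡ r) u≢v

module _ {n} (G : Digraph (suc n)) where

  mrad≤mecc : ∀ u → mrad G ≤ mecc G u
  mrad≤mecc u = foldr-⊓-≤ (mecc G) (mecc G zero) (∈-allFin u)

  mecc≤mdiam : ∀ u → mecc G u ≤ mdiam G
  mecc≤mdiam u = foldr-⊔-≥ (mecc G) 0 (∈-allFin u)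

  selfCentered⇔mecc≡ : ∀ {r} → (SelfCentered G × mrad G ≡ r) ⇔ (∀ u → mecc G u ≡ r)
  selfCentered⇔mecc≡ {r} = mk⇔ fwd bwd
    where
    fwd : SelfCentered G × mrad G ≡ r → ∀ u → mecc G u ≡ r
    fwd (rad≡diam , rad≡r) u =
      ≤-antisym (≤-trans (mecc≤mdiam u) (≤-reflexive (trans (sym rad≡diam) rad≡r)))
                (≤-trans (≤-reflexive (sym rad≡r)) (mrad≤mecc u))

    bwd : (∀ u → mecc G u ≡ r) → SelfCentered G × mrad G ≡ r
    bwd ecc≡r = trans rad≡r (sym diam≡r) , rad≡r
      where
      rad≡r : mrad G ≡ r
      rad≡r = ≤-antisym (≤-trans (mrad≤mecc zero) (≤-reflexive (ecc≡r zero)))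
                        (foldr-⊓-glb (≤-reflexive (sym (ecc≡r zero))) (≤-reflexive ∘ sym ∘ ecc≡r) (allFin (suc n)))
      diam≡r : mdiam G ≡ r
      diam≡r = ≤-antisym (foldr-⊔-lub z≤n (≤-reflexive ∘ ecc≡r) (allFin (suc n)))
                         (≤-trans (≤-reflexive (sym (ecc≡r zero))) (mecc≤mdiam zero))

module _ {m} (D : Digraph (2 + m)) (sD : StronglyConnected D) (sC : StronglyConnected (complement D)) where

  private
    n = 2 + m
    C = complement D

  2≤mecc : ∀ u → 2 ≤ mecc D u
  2≤mecc u with stronglyConnected⇒out-arc C sC u
  ... | v , ca = ¬arc⇒2≤mecc D (proj₁ (arc-complement⇒ D ca)) (proj₂ (arc-complement⇒ D ca))

  2≤mecc-complement : ∀ u → 2 ≤ mecc C u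
  2≤mecc-complement u with stronglyConnected⇒out-arc D sD u
  ... | v , a = ¬arc⇒2≤mecc C (arc⇒≢ D a) (arc⇒¬arc-complement D a)

  deg-nonZero : ∀ u → NonZero (deg D u)
  deg-nonZero u = >-nonZero (arc⇒0<deg D (proj₂ (stronglyConnected⇒out-arc D sD u)))

  deg-complement-nonZero : ∀ u → NonZero (deg C u)
  deg-complement-nonZero u = >-nonZero (arc⇒0<deg C (proj₂ (stronglyConnected⇒out-arc C sC u)))

  contribution : Fin n → ℕ
  contribution u = deg D u * mecc D u + deg C u * mecc C u

  floor : ℕ
  floor = 2 * (n ∸ 1) * 2

  floor≤contribution : ∀ u → floor ≤ contribution u
  floor≤contribution u = subst (_≤ contribution u) (cong (_* 2) (deg-complement D u))
    ([a+b]*c≤a*x+b*y {deg D u} {deg C u} (2≤mecc u) (2≤mecc-complement u))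

  floor≡contribution⇔ : ∀ u → (floor ≡ contribution u) ⇔ (mecc D u ≡ 2 × mecc C u ≡ 2)
  floor≡contribution⇔ u =
    subst (λ f → (f ≡ contribution u) ⇔ (mecc D u ≡ 2 × mecc C u ≡ 2)) (cong (_* 2) (deg-complement D u))
      ([a+b]*c≡a*x+b*y⇔x≡c×y≡c {deg D u} {deg C u} {{deg-nonZero u}} {{deg-complement-nonZero u}} (2≤mecc u) (2≤mecc-complement u))

  sum-floor : sumV {n} (λ _ → floor) ≡ 4 * n * (n ∸ 1)
  sum-floor = trans (sum-map-const floor (allFin n))
                    (trans (cong (_* floor) (length-tabulate {n = n} id)) (reassoc n (n ∸ 1)))
    where
    reassoc : ∀ a k → a * (2 * k * 2) ≡ 4 * a * k
    reassoc = solve-∀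

  twiceXiC-+ : twiceXiC D + twiceXiC C ≡ sumV contribution
  twiceXiC-+ = sym (sum-map-+ (λ u → deg D u * mecc D u) (λ u → deg C u * mecc C u) (allFin n))

  4n[n-1]≤twiceXiC-+ : 4 * n * (n ∸ 1) ≤ twiceXiC D + twiceXiC C
  4n[n-1]≤twiceXiC-+ = subst₂ _≤_ sum-floor (sym twiceXiC-+) (sum-map-mono floor≤contribution (allFin n))

  twiceXiC-+≡⇔mecc≡2 : (twiceXiC D + twiceXiC C ≡ 4 * n * (n ∸ 1)) ⇔ (∀ u → mecc D u ≡ 2 × mecc C u ≡ 2)
  twiceXiC-+≡⇔mecc≡2 = mk⇔ fwd bwd
    where
    fwd : twiceXiC D + twiceXiC C ≡ 4 * n * (n ∸ 1) → ∀ u → mecc D u ≡ 2 × mecc C u ≡ 2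
    fwd eq u = to (floor≡contribution⇔ u)
      (sum-map-≡⇒≡ floor≤contribution (trans sum-floor (trans (sym eq) twiceXiC-+)) (∈-allFin u))

    bwd : (∀ u → mecc D u ≡ 2 × mecc C u ≡ 2) → twiceXiC D + twiceXiC C ≡ 4 * n * (n ∸ 1)
    bwd mecc≡2 = trans twiceXiC-+
      (trans (cong sum (map-cong (λ u → sym (from (floor≡contribution⇔ u) (mecc≡2 u))) (allFin n))) sum-floor)

corollary2 : (n : ℕ) → 4 ≤ n → (D : Digraph n) →
    StronglyConnected D → StronglyConnected (complement D) →
    (4 * n * (n ∸ 1) ≤ twiceXiC D + twiceXiC (complement D))
    × ((twiceXiC D + twiceXiC (complement D) ≡ 4 * n * (n ∸ 1)) ⇔
       ((SelfCentered D × mrad D ≡ 2) × (SelfCentered (complement D) × mrad (complement D) ≡ 2)))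
corollary2 1 (s≤s ()) _ _ _
corollary2 (suc (suc m)) _ D sD sC = 4n[n-1]≤twiceXiC-+ D sD sC , mk⇔ fwd bwd
  where
  C = complement D

  fwd : twiceXiC D + twiceXiC C ≡ 4 * (2 + m) * (1 + m) → (SelfCentered D × mrad D ≡ 2) × (SelfCentered C × mrad C ≡ 2)
  fwd eq = from (selfCentered⇔mecc≡ D) (proj₁ ∘ mecc≡2) , from (selfCentered⇔mecc≡ C) (proj₂ ∘ mecc≡2)
    where
    mecc≡2 : ∀ u → mecc D u ≡ 2 × mecc C u ≡ 2
    mecc≡2 = to (twiceXiC-+≡⇔mecc≡2 D sD sC) eq

  bwd : (SelfCentered D × mrad D ≡ 2) × (SelfCentered C × mrad C ≡ 2) → twiceXiC D + twiceXiC C ≡ 4 * (2 + m) * (1 + m)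
  bwd (scD , scC) = from (twiceXiC-+≡⇔mecc≡2 D sD sC) λ u → to (selfCentered⇔mecc≡ D) scD u , to (selfCentered⇔mecc≡ C) scC u
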